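{- Let $q$ be a prime power and $m\ge 2$ an integer. The bipartite graph $\Gamma_{q,m}$ satisfies: (i) every $x\in X$ has degree $q^{m-1}$; (ii) every $y\in Y$ has degree $q$; (iii) any two distinct $y_1,y_2\in Y$ have at most $m-1$ common neighbours.
   Context: For a prime power $q$ and integer $m$, $\Gamma_{q,m}$ is the bipartite graph with parts $X=\mathbb{F}_q^2$ and $Y=\mathbb{F}_q^m$, where $x=(x_0,x_1)\in X$ and $y=(y_0,\dots,y_{m-1})\in Y$ are adjacent if and only if $x_1=\sum_{i=0}^{m-1}y_ix_0^i$. -}

module Defs where

open import Level using (0ℓ)
open import Data.Nat using (ℕ; zero; suc; _≤_; _^_)
open import Data.Nat.Primality using (Prime)
open import Data.Fin using (Fin)
open import Data.Vec using (Vec; []; _∷_)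
open import Data.Product using (Σ; ∃; _×_; _,_)
open import Relation.Binary.PropositionalEquality using (_≡_)
open import Relation.Nullary using (¬_)
open import Algebra.Structures using (IsCommutativeRing)
open import Function.Bundles using (_↔_)

IsPrimePower : ℕ → Set
IsPrimePower q = Σ ℕ λ p → Σ ℕ λ k → Prime p × (1 ≤ k) × (q ≡ p ^ k)

record FiniteField (q : ℕ) : Set₁ where
  infixl 6 _+_
  infixl 7 _*_
  field
    Carrier : Set
    _+_ _*_ : Carrier → Carrier → Carrier
    -_      : Carrier → Carrier
    0# 1#   : Carrier
    isCommutativeRing : IsCommutativeRing _≡_ _+_ _*_ -_ 0# 1#
    0≢1     : ¬ (0# ≡ 1#)
    inverse : (x : Carrier) → ¬ (x ≡ 0#) → Σ Carrier λ y → x * y ≡ 1#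
    enumeration : Carrier ↔ Fin q

  pow : Carrier → ℕ → Carrier
  pow x zero    = 1#
  pow x (suc n) = x * pow x n

  evalFrom : {n : ℕ} → ℕ → Vec Carrier n → Carrier → Carrier
  evalFrom k []       x = 0#
  evalFrom k (y ∷ ys) x = y * pow x k + evalFrom (suc k) ys x

  eval : {m : ℕ} → Vec Carrier m → Carrier → Carrier
  eval ys x = evalFrom 0 ys x

module Gamma {q : ℕ} (F : FiniteField q) (m : ℕ) where
  open FiniteField F

  X : Set
  X = Carrier × Carrier

  Y : Set
  Y = Vec Carrier m

  Adj : X → Y → Set
  Adj (x₀ , x₁) y = x₁ ≡ eval y x₀

  -- neighbourhoods (as types; their cardinality is the degree)
  NbrX : X → Set
  NbrX x = Σ Y λ y → Adj x y

  NbrY : Y → Set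
  NbrY y = Σ X λ x → Adj x y

  CommonNbr : Y → Y → Set
  CommonNbr y₁ y₂ = Σ X λ x → Adj x y₁ × Adj x y₂

-- For fixed y the neighbours (x₀ , x₁) of y are the graph of x₀ ↦ y(x₀), and for fixed
-- (x₀ , x₁) the constant coefficient of a neighbour y is forced by the other m - 1; this gives
-- (ii) and (i). A common neighbour of y₁ ≠ y₂ is determined by its abscissa x₀, at which the
-- polynomials y₁ and y₂ agree. Synthetic division by X - a shows that a polynomial with m
-- coefficients is determined by its values at m distinct points, so there are at most m - 1
-- such x₀, which gives (iii).
module Submission where

open import Level using (Level; 0ℓ)
open import Data.Nat using (ℕ; zero; suc; s≤s; _≤_; _∸_; _^_)
open import Data.Nat.Properties using (_<?_; ≮⇒≥)
open import Data.Fin using (Fin; inject≤)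
open import Data.Fin.Properties using (inject≤-injective; *↔×; inj⇒≟)
open import Data.Product using (Σ; _×_; _,_; proj₁; proj₂)
open import Data.Product.Function.NonDependent.Propositional using (_×-↔_)
open import Data.Vec using (Vec; []; _∷_)
open import Data.Vec.Properties using (∷-injective)
open import Data.List using (List; _∷_; map; allFin; filter; length; lookup)
import Data.List.Relation.Unary.All as All
open import Data.List.Relation.Unary.All using (All; _∷_)
open import Data.List.Relation.Unary.All.Properties using (all-filter)
open import Data.List.Relation.Unary.AllPairs using (_∷_)
open import Data.List.Relation.Unary.Any using (index)
open import Data.List.Relation.Unary.Any.Properties using (lookup-index)
open import Data.List.Relation.Unary.Unique.Propositional using (Unique)
import Data.List.Relation.Unary.Unique.Propositional.Properties as Unique
open import Data.List.Membership.Propositional using (_∈_)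
open import Data.List.Membership.Propositional.Properties using (∈-map⁺; ∈-allFin; ∈-filter⁺)
open import Data.Empty using (⊥-elim)
open import Relation.Nullary using (¬_; yes; no; Irrelevant)
open import Relation.Unary using (Decidable)
open import Relation.Binary.Definitions using (DecidableEquality)
open import Relation.Binary.PropositionalEquality
  using (_≡_; refl; sym; trans; cong; cong₂; subst; module ≡-Reasoning)
open import Function.Bundles using (Inverse; _↔_; _↣_; mk↔ₛ′; mk↣)
open import Function.Properties.Inverse using (↔-trans; ↔-sym; ↔⇒↣)
open import Algebra.Bundles using (CommutativeRing)
import Algebra.Properties.Group as GroupProperties
import Axiom.UniquenessOfIdentityProofs as UIP

open import Defs

private
  variable
    a b : Level
    A B : Set a

Σ-≡-irrelevant : {P : A → Set b} → (∀ {x} → Irrelevant (P x)) →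
                 {u v : Σ A P} → proj₁ u ≡ proj₁ v → u ≡ v
Σ-≡-irrelevant irr {x , p} {.x , p′} refl = cong (x ,_) (irr p p′)

graph↔domain : (f : A → B) → Σ (A × B) (λ p → proj₂ p ≡ f (proj₁ p)) ↔ A
graph↔domain f = mk↔ₛ′ (λ p → proj₁ (proj₁ p)) (λ x → (x , f x) , refl)
  (λ _ → refl) (λ { ((x , .(f x)) , refl) → refl })

Vec↔× : ∀ {n} → Vec A (suc n) ↔ (A × Vec A n)
Vec↔× = mk↔ₛ′ (λ { (x ∷ xs) → x , xs }) (λ (x , xs) → x ∷ xs)
  (λ _ → refl) (λ { (_ ∷ _) → refl })

↣Fin-via-list : {S : Set b} {xs : List A} {k : ℕ} (f : S → A) →
                (∀ {s t} → f s ≡ f t → s ≡ t) → (∀ s → f s ∈ xs) →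
                length xs ≤ k → S ↣ Fin k
↣Fin-via-list {S = S} {xs} {k} f f-injective f∈xs len≤k = mk↣ injective
  where
  position : S → Fin k
  position s = inject≤ (index (f∈xs s)) len≤k
  injective : ∀ {s t} → position s ≡ position t → s ≡ t
  injective {s} {t} eq = f-injective (begin
    f s                          ≡⟨ lookup-index (f∈xs s) ⟩
    lookup xs (index (f∈xs s))   ≡⟨ cong (lookup xs) (inject≤-injective len≤k len≤k _ _ eq) ⟩
    lookup xs (index (f∈xs t))   ≡⟨ lookup-index (f∈xs t) ⟨
    f t                          ∎)
    where open ≡-Reasoning

module Enumeration {q : ℕ} (enum : A ↔ Fin q) where
  open Inverse enum

  elements : List A
  elements = map from (allFin q)

  elements-unique : Unique elements
  elements-unique = Unique.map⁺ from-injective (Unique.allFin⁺ q)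
    where
    from-injective : ∀ {i j} → from i ≡ from j → i ≡ j
    from-injective {i} {j} eq =
      trans (sym (strictlyInverseˡ i)) (trans (cong to eq) (strictlyInverseˡ j))

  ∈-elements : ∀ x → x ∈ elements
  ∈-elements x = subst (_∈ elements) (strictlyInverseʳ x) (∈-map⁺ from (∈-allFin (to x)))

  Vec↔Fin^ : ∀ n → Vec A n ↔ Fin (q ^ n)
  Vec↔Fin^ zero = mk↔ₛ′ (λ _ → Fin.zero) (λ _ → [])
    (λ { Fin.zero → refl ; (Fin.suc ()) }) (λ { [] → refl })
  Vec↔Fin^ (suc n) = ↔-trans Vec↔× (↔-trans (enum ×-↔ Vec↔Fin^ n) (↔-sym *↔×))

module Polynomials {q : ℕ} (F : FiniteField q) where
  open FiniteField F
  open Enumeration enumeration using (elements; elements-unique; ∈-elements)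

  ring : CommutativeRing 0ℓ 0ℓ
  ring = record { isCommutativeRing = isCommutativeRing }
  open CommutativeRing ring
    using (+-group; +-comm; *-identityˡ; *-identityʳ; zeroʳ; commutativeSemiring)
  open GroupProperties +-group
    using (∙-cancelˡ; ∙-cancelʳ; //-rightDividesˡ; //-rightDividesʳ; x∙y⁻¹≈ε⇒x≈y)
  open import Algebra.Solver.Ring.NaturalCoefficients.Default commutativeSemiring
  open ≡-Reasoning

  infixl 6 _-_
  _-_ : Carrier → Carrier → Carrier
  x - y = x + - y

  _≟_ : DecidableEquality Carrier
  _≟_ = inj⇒≟ (↔⇒↣ enumeration)

  ≡-irrelevant : {x y : Carrier} → Irrelevant (x ≡ y)
  ≡-irrelevant = UIP.Decidable⇒UIP.≡-irrelevant _≟_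

  *-cancelˡ-nonzero : ∀ x {y z} → ¬ x ≡ 0# → x * y ≡ x * z → y ≡ z
  *-cancelˡ-nonzero x {y} {z} x≢0 eq with inverse x x≢0
  ... | x⁻¹ , xx⁻¹≡1 = begin
    y                ≡⟨ divide y ⟨
    x⁻¹ * (x * y)    ≡⟨ cong (x⁻¹ *_) eq ⟩
    x⁻¹ * (x * z)    ≡⟨ divide z ⟩
    z                ∎
    where
    divide : ∀ w → x⁻¹ * (x * w) ≡ w
    divide w = begin
      x⁻¹ * (x * w)
        ≡⟨ solve 3 (λ x x⁻¹ w → x⁻¹ :* (x :* w) := (x :* x⁻¹) :* w) refl x x⁻¹ w ⟩
      (x * x⁻¹) * w  ≡⟨ cong (_* w) xx⁻¹≡1 ⟩
      1# * w         ≡⟨ *-identityˡ w ⟩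
      w              ∎

  horner : ∀ {n} → Vec Carrier n → Carrier → Carrier
  horner []       x = 0#
  horner (c ∷ cs) x = c + x * horner cs x

  evalFrom≡pow*horner : ∀ {n} k (cs : Vec Carrier n) x → evalFrom k cs x ≡ pow x k * horner cs x
  evalFrom≡pow*horner k []       x = sym (zeroʳ (pow x k))
  evalFrom≡pow*horner k (c ∷ cs) x = begin
    c * pow x k + evalFrom (suc k) cs x  ≡⟨ cong (c * pow x k +_) (evalFrom≡pow*horner (suc k) cs x) ⟩
    c * pow x k + (x * pow x k) * H
      ≡⟨ solve 4 (λ c P x H → c :* P :+ (x :* P) :* H := P :* (c :+ x :* H)) refl c (pow x k) x H ⟩
    pow x k * (c + x * H)                ∎
    where
    H : Carrier
    H = horner cs x

  eval≡horner : ∀ {n} (cs : Vec Carrier n) x → eval cs x ≡ horner cs x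
  eval≡horner cs x = trans (evalFrom≡pow*horner 0 cs x) (*-identityˡ (horner cs x))

  -- Synthetic division by X - a; the remainder is horner p a.
  quotient : ∀ {n} → Carrier → Vec Carrier (suc n) → Vec Carrier n
  quotient a (c ∷ [])      = []
  quotient a (c ∷ c′ ∷ cs) = horner (c′ ∷ cs) a ∷ quotient a (c′ ∷ cs)

  horner-quotient : ∀ {n} a (p : Vec Carrier (suc n)) x →
                    horner p x ≡ horner p a + (x - a) * horner (quotient a p) x
  horner-quotient a (c ∷ []) x =
    solve 4 (λ c a x na → c :+ x :* con 0 := (c :+ a :* con 0) :+ (x :+ na) :* con 0) refl c a x (- a)
  horner-quotient a (c ∷ p@(_ ∷ _)) x = begin
    c + x * horner p x                  ≡⟨ cong (λ t → c + x * t) (horner-quotient a p x) ⟩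
    c + x * (r + d * Q)                 ≡⟨ cong (λ t → c + t * (r + d * Q)) x≡a+d ⟩
    c + (a + d) * (r + d * Q)
      ≡⟨ solve 5 (λ c a d r Q → c :+ (a :+ d) :* (r :+ d :* Q)
                             := (c :+ a :* r) :+ d :* (r :+ (a :+ d) :* Q)) refl c a d r Q ⟩
    (c + a * r) + d * (r + (a + d) * Q) ≡⟨ cong (λ t → (c + a * r) + d * (r + t * Q)) x≡a+d ⟨
    (c + a * r) + d * (r + x * Q)       ∎
    where
    r Q d : Carrier
    r = horner p a
    Q = horner (quotient a p) x
    d = x - a
    x≡a+d : x ≡ a + d
    x≡a+d = trans (sym (//-rightDividesˡ a x)) (+-comm d a)

  remainder-quotient-injective : ∀ {n} a (p p′ : Vec Carrier (suc n)) →
    horner p a ≡ horner p′ a → quotient a p ≡ quotient a p′ → p ≡ p′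
  remainder-quotient-injective a (c ∷ []) (c′ ∷ []) same-remainder _ =
    cong (_∷ []) (∙-cancelʳ (a * 0#) c c′ same-remainder)
  remainder-quotient-injective a (c ∷ p@(_ ∷ _)) (c′ ∷ p′@(_ ∷ _)) same-remainder same-quotient
    with ∷-injective same-quotient
  ... | p-a≡p′-a , same-quotient′ = cong₂ _∷_
    (∙-cancelʳ (a * horner p a) c c′
      (trans same-remainder (cong (λ t → c′ + a * t) (sym p-a≡p′-a))))
    (remainder-quotient-injective a p p′ p-a≡p′-a same-quotient′)

  quotient-agrees : ∀ {n a b} (p p′ : Vec Carrier (suc n)) → ¬ a ≡ b →
    horner p a ≡ horner p′ a → horner p b ≡ horner p′ b →
    horner (quotient a p) b ≡ horner (quotient a p′) b
  quotient-agrees {a = a} {b} p p′ a≢b agree-a agree-b =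
    *-cancelˡ-nonzero (b - a) (λ b-a≡0 → a≢b (sym (x∙y⁻¹≈ε⇒x≈y b a b-a≡0)))
      (∙-cancelˡ (horner p a) _ _ (begin
        horner p a + (b - a) * horner (quotient a p) b   ≡⟨ horner-quotient a p b ⟨
        horner p b                                       ≡⟨ agree-b ⟩
        horner p′ b                                      ≡⟨ horner-quotient a p′ b ⟩
        horner p′ a + (b - a) * horner (quotient a p′) b ≡⟨ cong (_+ _) agree-a ⟨
        horner p a + (b - a) * horner (quotient a p′) b  ∎))

  agree-on-distinct⇒≡ : ∀ n (p p′ : Vec Carrier n) (xs : List Carrier) → Unique xs →
    All (λ x → horner p x ≡ horner p′ x) xs → n ≤ length xs → p ≡ p′
  agree-on-distinct⇒≡ zero [] [] _ _ _ _ = refl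
  agree-on-distinct⇒≡ (suc n) p p′ (a ∷ xs) (a∉xs ∷ xs-unique) (agree-a ∷ agree) (s≤s n≤len) =
    remainder-quotient-injective a p p′ agree-a
      (agree-on-distinct⇒≡ n (quotient a p) (quotient a p′) xs xs-unique
        (All.zipWith (λ (a≢x , agree-x) → quotient-agrees p p′ a≢x agree-a agree-x) (a∉xs , agree))
        n≤len)

  agree? : ∀ {n} (p p′ : Vec Carrier n) → Decidable (λ x → eval p x ≡ eval p′ x)
  agree? p p′ x = eval p x ≟ eval p′ x

  agreement : ∀ {n} → Vec Carrier n → Vec Carrier n → List Carrier
  agreement p p′ = filter (agree? p p′) elements

  ∈-agreement : ∀ {n} {p p′ : Vec Carrier n} {x} → eval p x ≡ eval p′ x → x ∈ agreement p p′
  ∈-agreement {p = p} {p′} {x} = ∈-filter⁺ (agree? p p′) (∈-elements x)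

  agreement-length : ∀ {n} (p p′ : Vec Carrier (suc n)) → ¬ p ≡ p′ →
                     length (agreement p p′) ≤ n
  agreement-length {n} p p′ p≢p′ with n <? length (agreement p p′)
  ... | no  n≮len = ≮⇒≥ n≮len
  ... | yes n<len = ⊥-elim (p≢p′ (agree-on-distinct⇒≡ (suc n) p p′ (agreement p p′)
          (Unique.filter⁺ (agree? p p′) elements-unique)
          (All.map (λ {x} e → trans (sym (eval≡horner p x)) (trans e (eval≡horner p′ x)))
                   (all-filter (agree? p p′) elements))
          n<len))

module Neighbourhoods {q : ℕ} (F : FiniteField q) where
  open FiniteField F
  open Polynomials F
  open CommutativeRing ring using (+-group; *-identityʳ)
  open GroupProperties +-group using (//-rightDividesˡ; //-rightDividesʳ)

  module _ (m : ℕ) where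
    open Gamma F m

    NbrY↔Carrier : (y : Y) → NbrY y ↔ Carrier
    NbrY↔Carrier y = graph↔domain (eval y)

  module _ (n : ℕ) where
    open Gamma F (suc n)

    NbrX↔Vec : (x : X) → NbrX x ↔ Vec Carrier n
    NbrX↔Vec (x₀ , x₁) = mk↔ₛ′ (λ { ((_ ∷ ys) , _) → ys }) from (λ _ → refl)
      (λ { ((c ∷ ys) , adj) →
             Σ-≡-irrelevant ≡-irrelevant (cong (_∷ ys) (sym (constant {c} {ys} adj))) })
      where
      higher : Vec Carrier n → Carrier
      higher ys = evalFrom 1 ys x₀
      from : Vec Carrier n → NbrX (x₀ , x₁)
      from ys = (x₁ - higher ys ∷ ys) ,
        trans (sym (//-rightDividesˡ (higher ys) x₁)) (cong (_+ higher ys) (sym (*-identityʳ _)))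
      constant : ∀ {c ys} → x₁ ≡ c * 1# + higher ys → c ≡ x₁ - higher ys
      constant {c} {ys} adj = trans (sym (*-identityʳ c))
        (trans (sym (//-rightDividesʳ (higher ys) (c * 1#))) (cong (_- higher ys) (sym adj)))

    CommonNbr↣Fin : (y₁ y₂ : Y) → ¬ y₁ ≡ y₂ → CommonNbr y₁ y₂ ↣ Fin n
    CommonNbr↣Fin y₁ y₂ y₁≢y₂ =
      ↣Fin-via-list (λ u → proj₁ (proj₁ u)) abscissa-injective
        (λ { (_ , adj₁ , adj₂) → ∈-agreement {p = y₁} {y₂} (trans (sym adj₁) adj₂) })
        (agreement-length y₁ y₂ y₁≢y₂)
      where
      abscissa-injective : ∀ {u v : CommonNbr y₁ y₂} →
                           proj₁ (proj₁ u) ≡ proj₁ (proj₁ v) → u ≡ v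
      abscissa-injective {(x₀ , _) , adj₁ , _} {_ , adj₁′ , _} x₀≡x₀′ =
        Σ-≡-irrelevant
          (λ (p , p′) (r , r′) → cong₂ _,_ (≡-irrelevant p r) (≡-irrelevant p′ r′))
          (cong₂ _,_ x₀≡x₀′ (trans adj₁ (trans (cong (eval y₁) x₀≡x₀′) (sym adj₁′))))

proposition2p2 : (q : ℕ) → IsPrimePower q → (F : FiniteField q) → (m : ℕ) → 2 ≤ m →
    let open Gamma F m in
      ((x : X) → NbrX x ↔ Fin (q ^ (m ∸ 1)))
      × ((y : Y) → NbrY y ↔ Fin q)
      × ((y₁ y₂ : Y) → ¬ (y₁ ≡ y₂) → CommonNbr y₁ y₂ ↣ Fin (m ∸ 1))
proposition2p2 q _ F (suc n) (s≤s _) =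
  (λ x → ↔-trans (NbrX↔Vec n x) (Vec↔Fin^ n)) ,
  (λ y → ↔-trans (NbrY↔Carrier (suc n) y) enumeration) ,
  CommonNbr↣Fin n
  where
  open FiniteField F using (enumeration)
  open Enumeration enumeration using (Vec↔Fin^)
  open Neighbourhoods F
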